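{- Let $f:\{0,1\}^n\to\{0,1\}^n$ be a Boolean network whose interaction graph $G(f)$ has no positive cycles, and let $y\in\{0,1\}^n$. The following propositions are equivalent: (1) $y$ is the unique fixed point of $f$; (2) for every $x\in\{0,1\}^n$, $f^{\langle n\rangle}(x)=y$; (3) there exists a sequential schedule $\pi$ such that for every $x\in\{0,1\}^n$, $f^{\pi}(x)=y$.
   Context: A Boolean network (BN) with $n$ components is a map $f=(f_1,\dots,f_n):\{0,1\}^n\to\{0,1\}^n$; $f_i$ is the local activation function of component $i$. A fixed point is $x$ with $f(x)=x$. For $u\in[n]=\{1,\dots,n\}$, $e_u$ is the $u$-th unit vector. The interaction graph $G(f)$ is the signed digraph on vertex set $[n]$ with a positive arc $(u,v)$ if there is $x$ with $x_u=0$ and $f_v(x)<f_v(x+e_u)$, and a negative arc $(u,v)$ if there is $x$ with $x_u=0$ and $f_v(x)>f_v(x+e_u)$ (both may exist). A cycle is a closed directed path; its sign is the product of the signs of its arcs, and it is positive if the sign is $+1$. $f^{\langle 0\rangle}$ is the identity and $f^{\langle k\rangle}=f\circ f^{\langle k-1\rangle}$. For $u\in[n]$, $f^u(x)=(x_1,\dots,x_{u-1},f_u(x),x_{u+1},\dots,x_n)$. A sequential schedule is a permutation $\pi=(\pi_1,\dots,\pi_n)$ of $[n]$, and $f^{\pi}=f^{\pi_n}\circ\cdots\circ f^{\pi_1}$. -}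

module Defs where

open import Data.Nat using (ℕ; zero; suc)
open import Data.Bool using (Bool; true; false; not; _xor_)
open import Data.Fin using (Fin)
open import Data.Vec using (Vec; lookup; _[_]≔_; allFin)
open import Data.List using (List; []; _∷_)
open import Data.List.Relation.Unary.Unique.Propositional using (Unique)
open import Data.Product using (∃; _×_; _,_)
open import Relation.Binary.PropositionalEquality using (_≡_)
open import Function using (_∘_; id)

-- Configurations x ∈ {0,1}^n, with 0 = false, 1 = true.
Config : ℕ → Set
Config n = Vec Bool n

BN : ℕ → Set
BN n = Config n → Config n

local : ∀ {n} → BN n → Fin n → Config n → Bool
local f v x = lookup (f x) v

-- x + e_u for x with x_u = 0
_+e_ : ∀ {n} → Config n → Fin n → Config n
x +e u = x [ u ]≔ true

PosArc : ∀ {n} → BN n → Fin n → Fin n → Set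
PosArc f u v = ∃ λ x → lookup x u ≡ false × local f v x ≡ false × local f v (x +e u) ≡ true

NegArc : ∀ {n} → BN n → Fin n → Fin n → Set
NegArc f u v = ∃ λ x → lookup x u ≡ false × local f v x ≡ true × local f v (x +e u) ≡ false

-- Signed arc; the Bool is "is negative" (sign −1 ↔ true).
Arc : ∀ {n} → BN n → Bool → Fin n → Fin n → Set
Arc f false u v = PosArc f u v
Arc f true  u v = NegArc f u v

-- Walk f u w neg vs : a directed walk in G(f) from u to w, with chosen
-- signed arcs, whose number of negative arcs has parity neg, and where
-- vs lists the vertices the walk leaves (i.e. all vertices except the last).
data Walk {n} (f : BN n) : Fin n → Fin n → Bool → List (Fin n) → Set where
  [] : ∀ {u} → Walk f u u false []
  step : ∀ {u v w s p vs} → Arc f s u v → Walk f v w p vs →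
         Walk f u w (s xor p) (u ∷ vs)

-- A positive cycle: a closed walk u → … → u of length ≥ 1 visiting
-- pairwise distinct vertices (a cycle), with sign +1 (even number of
-- negative arcs).
HasPositiveCycle : ∀ {n} → BN n → Set
HasPositiveCycle {n} f =
  ∃ λ (u : Fin n) → ∃ λ (vs : List (Fin n)) →
    Walk f u u false (u ∷ vs) × Unique (u ∷ vs)

iter : ∀ {n} → BN n → ℕ → BN n
iter f zero    = id
iter f (suc k) = f ∘ iter f k

update : ∀ {n} → BN n → Fin n → BN n
update f u x = x [ u ]≔ local f u x

-- f^π = f^{π_n} ∘ … ∘ f^{π_1}; π is a permutation of Fin n
-- represented as a list [π_1, …, π_n]; permutation-ness is imposed in the statement.
sequential : ∀ {n} → BN n → List (Fin n) → BN n
sequential f []       = id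
sequential f (u ∷ us) = sequential f us ∘ update f u

FixedPoint : ∀ {n} → BN n → Config n → Set
FixedPoint f x = f x ≡ x

UniqueFixedPoint : ∀ {n} → BN n → Config n → Set
UniqueFixedPoint f y = FixedPoint f y × (∀ x → FixedPoint f x → x ≡ y)

-- Relabel every arc j → i of G(f) by y_j xor y_i. Going once around a closed walk these
-- labels telescope to 0, so a cycle all of whose signs equal their labels is positive.
--
-- Suppose f y = y and, among the components not yet scheduled, none is forced to y_i by
-- agreement with y on the scheduled ones. A configuration x witnessing this for i differs
-- from y on some unscheduled coordinate, and walking from y to x one coordinate at a time
-- finds an unscheduled j and a flip of x_j changing f_i: an arc j → i whose sign is its
-- label. Every unscheduled component thus has a predecessor of that kind among the
-- unscheduled ones, which closes a positive cycle. So without positive cycles the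
-- components can be ordered i₁, …, iₙ with f_{iₖ} = y_{iₖ} on every x agreeing with y on
-- i₁, …, iₖ₋₁. Along this order both f^⟨n⟩ and the sequential update fix one more
-- coordinate per step, giving (1) ⇒ (2) ⇒ (3). For (3) ⇒ (1), a fixed point of f is
-- fixed by every f^π, and if f^π fixes y then, π being repetition-free, each f_u fixes y.
module Submission where

open import Defs
open import Data.Nat using (ℕ; zero; suc)
open import Data.Nat.Properties using (suc-injective)
open import Data.Fin using (Fin; zero; suc)
open import Data.Fin.Properties using (_≟_)
open import Data.Bool using (true; false; not; _xor_)
import Data.Bool.Properties as Bool
open import Data.Bool.Properties using (¬-not; xor-assoc; xor-same; xor-identityʳ)
open import Data.List as List using (List; []; _∷_; length; _++_; _ʳ++_)
open import Data.List.Properties using (length-tabulate)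
open import Data.List.Relation.Binary.Permutation.Propositional
  using (_↭_; ↭-refl; ↭-sym; ↭-trans; ↭-prep; ↭⇒↭ₛ)
open import Data.List.Relation.Binary.Permutation.Propositional.Properties
  using (All-resp-↭; ∈-resp-↭; ↭-length; shift; ++↭ʳ++)
import Data.List.Relation.Binary.Permutation.Setoid.Properties as Permutationₛ
open import Data.List.Relation.Binary.Subset.Propositional using (_⊆_)
open import Data.List.Relation.Binary.Subset.Propositional.Properties using (∷⁺ʳ)
open import Data.List.Relation.Unary.All as All using (All; []; _∷_; all?)
open import Data.List.Relation.Unary.All.Properties using (¬Any⇒All¬; All¬⇒¬Any; anti-mono)
open import Data.List.Relation.Unary.Any using (Any; here; there; any?)
open import Data.List.Relation.Unary.AllPairs using ([]; _∷_)
open import Data.List.Relation.Unary.Unique.Propositional using (Unique)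
open import Data.List.Relation.Unary.Unique.Propositional.Properties using (allFin⁺)
open import Data.List.Membership.Propositional using (_∈_; _∉_; find)
open import Data.List.Membership.Propositional.Properties using (∈-∃++; ∈-allFin; ∈-++⁺ˡ)
open import Data.Product using (∃; _×_; _,_)
open import Data.Sum using (_⊎_; inj₁; inj₂; [_,_]′)
open import Data.Empty using (⊥-elim)
open import Data.Vec as Vec using (lookup; allFin; toList; _[_]≔_)
open import Data.Vec.Properties using (lookup∘update; lookup∘update′; []≔-idempotent; []≔-lookup)
open import Data.Vec.Relation.Binary.Pointwise.Extensional using (ext; Pointwise-≡⇒≡)
open import Function using (_∘_; id)
open import Relation.Binary using (_Respects_)
open import Relation.Binary.PropositionalEquality as ≡
  using (_≡_; _≢_; refl; sym; trans; cong; subst; module ≡-Reasoning)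
open import Relation.Nullary using (¬_; yes; no; contradiction)
open import Relation.Unary using (Pred; Decidable)
open import Level using (0ℓ)

toList-tabulate : ∀ {A : Set} {m} (g : Fin m → A) → toList (Vec.tabulate g) ≡ List.tabulate g
toList-tabulate {m = zero}  g = refl
toList-tabulate {m = suc m} g = cong (g zero ∷_) (toList-tabulate (g ∘ suc))

toList-allFin : ∀ n → toList (allFin n) ≡ List.allFin n
toList-allFin n = toList-tabulate id

Unique-resp-↭ : ∀ {A : Set} → Unique {A = A} Respects _↭_
Unique-resp-↭ {A} p = Permutationₛ.Unique-resp-↭ (≡.setoid A) (↭⇒↭ₛ p)

∈⇒↭∷ : ∀ {A : Set} {x : A} {xs} → x ∈ xs → ∃ λ ys → xs ↭ x ∷ ys
∈⇒↭∷ x∈xs with ys , zs , refl ← ∈-∃++ x∈xs = ys ++ zs , shift _ ys zs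

Any⊎All : ∀ {A : Set} {P Q : Pred A 0ℓ} → (∀ x → P x ⊎ Q x) → ∀ xs → Any P xs ⊎ All Q xs
Any⊎All P⊎Q []       = inj₂ []
Any⊎All P⊎Q (x ∷ xs) with P⊎Q x | Any⊎All P⊎Q xs
... | inj₁ px | _           = inj₁ (here px)
... | inj₂ _  | inj₁ some   = inj₁ (there some)
... | inj₂ qx | inj₂ others = inj₂ (qx ∷ others)

Covers : ∀ {A : Set} → List A → List A → Set
Covers D R = ∀ v → v ∈ D ⊎ v ∈ R

Covers-move : ∀ {A : Set} {D R R′ : List A} {i} → Covers D R → R ↭ i ∷ R′ → Covers (i ∷ D) R′
Covers-move cov p v with cov v
... | inj₁ v∈D = inj₁ (there v∈D)
... | inj₂ v∈R with ∈-resp-↭ p v∈R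
...   | here v≡i    = inj₁ (here v≡i)
...   | there v∈R′ = inj₂ v∈R′

∀⊎∃ : ∀ {m} {P Q : Pred (Config m) 0ℓ} → (∀ x → P x ⊎ Q x) → (∀ x → P x) ⊎ ∃ Q
∀⊎∃ {zero} P⊎Q with P⊎Q Vec.[]
... | inj₁ p = inj₁ λ { Vec.[] → p }
... | inj₂ q = inj₂ (Vec.[] , q)
∀⊎∃ {suc m} P⊎Q with ∀⊎∃ (P⊎Q ∘ (true Vec.∷_)) | ∀⊎∃ (P⊎Q ∘ (false Vec.∷_))
... | inj₂ (x , q) | _            = inj₂ (true Vec.∷ x , q)
... | inj₁ _       | inj₂ (x , q) = inj₂ (false Vec.∷ x , q)
... | inj₁ ps      | inj₁ ps′     = inj₁ λ { (true Vec.∷ x) → ps x ; (false Vec.∷ x) → ps′ x }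

edge-across : ∀ {m} {Q : Pred (Config m) 0ℓ} → Decidable Q → ∀ z x → Q z → ¬ Q x →
  ∃ λ k → lookup z k ≢ lookup x k ×
    ∃ λ w → lookup w k ≡ lookup z k × Q w × ¬ Q (w [ k ]≔ lookup x k)
edge-across Q? Vec.[] Vec.[] qz ¬qx = contradiction qz ¬qx
edge-across {Q = Q} Q? (a Vec.∷ z) (c Vec.∷ x) qz ¬qx with Q? (c Vec.∷ z)
... | no ¬q = zero , (λ a≡c → ¬q (subst (λ b → Q (b Vec.∷ z)) a≡c qz)) , a Vec.∷ z , refl , qz , ¬q
... | yes q with k , z≢x , w , wk , qw , ¬qw′ ← edge-across (Q? ∘ (c Vec.∷_)) z x q ¬qx =
  suc k , z≢x , c Vec.∷ w , wk , qw , ¬qw′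

[]≔-restore : ∀ {m} (w : Config m) k {a b} → lookup w k ≡ b → (w [ k ]≔ a) [ k ]≔ b ≡ w
[]≔-restore w k {a} {b} wk = begin
  (w [ k ]≔ a) [ k ]≔ b  ≡⟨ []≔-idempotent w k ⟩
  w [ k ]≔ b              ≡⟨ cong (w [ k ]≔_) (sym wk) ⟩
  w [ k ]≔ lookup w k     ≡⟨ []≔-lookup w k ⟩
  w                       ∎
  where open ≡-Reasoning

module Paths {n} (E : Fin n → Fin n → Set) where

  data Path : Fin n → Fin n → List (Fin n) → Set where
    []  : ∀ {u} → Path u u []
    _∷_ : ∀ {u v w vs} → E u v → Path v w vs → Path u w (v ∷ vs)

  SimpleCycle : Set
  SimpleCycle = ∃ λ u → ∃ λ t → ∃ λ vs → Path u t vs × E t u × Unique (u ∷ vs)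

  prefix-to : ∀ {u w t vs} → Path u w vs → t ∈ u ∷ vs → Unique (u ∷ vs) →
    ∃ λ ws → Path u t ws × ws ⊆ vs × Unique (u ∷ ws)
  prefix-to _         (here refl) _ = [] , [] , (λ ()) , [] ∷ []
  prefix-to (e ∷ W) (there t∈) (u∉ ∷ uq) with ws , W′ , ws⊆ , uq′ ← prefix-to W t∈ uq =
    _ ∷ ws , e ∷ W′ , ∷⁺ʳ _ ws⊆ , anti-mono (∷⁺ʳ _ ws⊆) u∉ ∷ uq′

  backward-closed⇒SimpleCycle : (P : Pred (Fin n) 0ℓ) → (∀ {i} → P i → ∃ λ j → P j × E j i) →
    ∀ {h} → P h → SimpleCycle
  backward-closed⇒SimpleCycle P pred ph =
    grow _ (List.allFin n) refl ph [] ([] ∷ []) (λ v → inj₂ (∈-allFin v))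
    where
    extend : ∀ {h a vs pool} → P h → Path h a vs → Unique (h ∷ vs) → Covers (h ∷ vs) pool →
      SimpleCycle ⊎ ∃ λ h′ → P h′ × E h′ h × h′ ∉ h ∷ vs × h′ ∈ pool
    extend {h} {vs = vs} ph W uq cov with h′ , ph′ , e ← pred ph with any? (h′ ≟_) (h ∷ vs)
    ... | yes h′∈ with ws , W′ , _ , uq′ ← prefix-to W h′∈ uq = inj₁ (h , h′ , ws , W′ , e , uq′)
    ... | no h′∉ = inj₂ (h′ , ph′ , e , h′∉ , [ ⊥-elim ∘ h′∉ , id ]′ (cov h′))

    -- Walk backwards along a simple path; the fuel is the number of vertices not on it.
    grow : ∀ k pool → length pool ≡ k → ∀ {h a vs} → P h → Path h a vs → Unique (h ∷ vs) →
      Covers (h ∷ vs) pool → SimpleCycle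
    grow zero [] _ ph W uq cov with extend ph W uq cov
    ... | inj₁ c = c
    ... | inj₂ (_ , _ , _ , _ , ())
    grow (suc k) pool len ph W uq cov with extend ph W uq cov
    ... | inj₁ c = c
    ... | inj₂ (h′ , ph′ , e , h′∉ , h′∈) with pool′ , p ← ∈⇒↭∷ h′∈ =
      grow k pool′ (suc-injective (trans (sym (↭-length p)) len)) ph′ (e ∷ W)
        (¬Any⇒All¬ _ h′∉ ∷ uq) (Covers-move cov p)

module _ {n} (f : BN n) where

  flip⇒Arc : ∀ j i (w : Config n) {a b} → lookup w j ≡ a → local f i w ≡ b →
    local f i (w [ j ]≔ not a) ≡ not b → Arc f (a xor b) j i
  flip⇒Arc j i w {false} {false} wj fw fw′ = w , wj , fw , fw′
  flip⇒Arc j i w {false} {true}  wj fw fw′ = w , wj , fw , fw′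
  flip⇒Arc j i w {true}  {false} wj fw fw′ =
    w [ j ]≔ false , lookup∘update j w false , fw′ ,
    subst (λ v → local f i v ≡ false) (sym ([]≔-restore w j wj)) fw
  flip⇒Arc j i w {true}  {true}  wj fw fw′ =
    w [ j ]≔ false , lookup∘update j w false , fw′ ,
    subst (λ v → local f i v ≡ true) (sym ([]≔-restore w j wj)) fw

  iter-suc : ∀ k x → iter f (suc k) x ≡ iter f k (f x)
  iter-suc zero    x = refl
  iter-suc (suc k) x = cong f (iter-suc k x)

  iter-constant⇒fixed : ∀ k {y} → (∀ x → iter f k x ≡ y) → FixedPoint f y
  iter-constant⇒fixed k {y} const = begin
    f y                ≡⟨ cong f (sym (const y)) ⟩
    iter f (suc k) y   ≡⟨ iter-suc k y ⟩
    iter f k (f y)     ≡⟨ const (f y) ⟩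
    y                  ∎
    where open ≡-Reasoning

  update-fixed : ∀ u {x} → FixedPoint f x → update f u x ≡ x
  update-fixed u {x} fx = trans (cong (λ z → x [ u ]≔ lookup z u) fx) ([]≔-lookup x u)

  sequential-fixed : ∀ us {x} → FixedPoint f x → sequential f us x ≡ x
  sequential-fixed []       fx = refl
  sequential-fixed (u ∷ us) fx = trans (cong (sequential f us) (update-fixed u fx)) (sequential-fixed us fx)

  sequential-untouched : ∀ us z {j} → j ∉ us → lookup (sequential f us z) j ≡ lookup z j
  sequential-untouched []       z j∉ = refl
  sequential-untouched (u ∷ us) z j∉ =
    trans (sequential-untouched us (update f u z) (j∉ ∘ there)) (lookup∘update′ (j∉ ∘ here) z _)

  sequential-stationary : ∀ us {x} → Unique us → sequential f us x ≡ x →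
    All (λ u → local f u x ≡ lookup x u) us
  sequential-stationary []       _          _   = []
  sequential-stationary (u ∷ us) {x} (u∉ ∷ uq) seq = fu ∷ sequential-stationary us uq seq′
    where
    open ≡-Reasoning
    fu : local f u x ≡ lookup x u
    fu = begin
      local f u x                              ≡⟨ lookup∘update u x _ ⟨
      lookup (update f u x) u                  ≡⟨ sequential-untouched us (update f u x) (All¬⇒¬Any u∉) ⟨
      lookup (sequential f us (update f u x)) u ≡⟨ cong (λ z → lookup z u) seq ⟩
      lookup x u                               ∎
    seq′ : sequential f us x ≡ x
    seq′ = subst (λ z → sequential f us z ≡ x) (trans (cong (x [ u ]≔_) fu) ([]≔-lookup x u)) seq

  stationary⇒fixed : ∀ {x} → All (λ u → local f u x ≡ lookup x u) (List.allFin n) → FixedPoint f x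
  stationary⇒fixed stat = Pointwise-≡⇒≡ (ext λ u → All.lookup stat (∈-allFin u))

module Forcing {n} (f : BN n) (y : Config n) where

  Agree : List (Fin n) → Config n → Set
  Agree D x = All (λ j → lookup x j ≡ lookup y j) D

  Forced : List (Fin n) → Fin n → Set
  Forced D i = ∀ x → Agree D x → local f i x ≡ lookup y i

  data ForcingOrder : List (Fin n) → List (Fin n) → Set where
    []  : ∀ {D} → ForcingOrder D []
    _∷_ : ∀ {D i π} → Forced D i → ForcingOrder (i ∷ D) π → ForcingOrder D (i ∷ π)

  Closed : List (Fin n) → Set
  Closed D = ∀ x → Agree D x → Agree D (f x)

  Agree-complete : ∀ {L x} → (∀ j → j ∈ L) → Agree L x → x ≡ y
  Agree-complete complete agree = Pointwise-≡⇒≡ (ext λ j → All.lookup agree (complete j))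

  Agree-set : ∀ {D x} i → Agree D x → Agree (i ∷ D) (x [ i ]≔ lookup y i)
  Agree-set {x = x} i agree = lookup∘update i x (lookup y i) ∷ All.map set-agree agree
    where
    set-agree : ∀ {j} → lookup x j ≡ lookup y j → lookup (x [ i ]≔ lookup y i) j ≡ lookup y j
    set-agree {j} xj with i ≟ j
    ... | yes refl = lookup∘update i x (lookup y i)
    ... | no  i≢j  = trans (lookup∘update′ (i≢j ∘ sym) x (lookup y i)) xj

  Balanced : Fin n → Fin n → Set
  Balanced j i = Arc f (lookup y j xor lookup y i) j i

  open Paths Balanced

  balanced-walk : ∀ {u t h vs} → Path u t vs → Balanced t h →
    Walk f u h (lookup y u xor lookup y h) (u ∷ vs)
  balanced-walk {h = h} [] e = subst (λ s → Walk f _ h s _) (xor-identityʳ _) (step e [])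
  balanced-walk {u} {h = h} (_∷_ {v = v} e W) e′ =
    subst (λ s → Walk f u h s _) telescope (step e (balanced-walk W e′))
    where
    open ≡-Reasoning
    telescope : (lookup y u xor lookup y v) xor (lookup y v xor lookup y h) ≡ lookup y u xor lookup y h
    telescope = begin
      (lookup y u xor lookup y v) xor (lookup y v xor lookup y h) ≡⟨ xor-assoc (lookup y u) _ _ ⟩
      lookup y u xor (lookup y v xor (lookup y v xor lookup y h)) ≡⟨ cong (lookup y u xor_) (xor-assoc (lookup y v) _ _) ⟨
      lookup y u xor ((lookup y v xor lookup y v) xor lookup y h) ≡⟨ cong (λ b → lookup y u xor (b xor lookup y h)) (xor-same (lookup y v)) ⟩
      lookup y u xor lookup y h                                   ∎

  SimpleCycle⇒positive : SimpleCycle → HasPositiveCycle f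
  SimpleCycle⇒positive (u , _ , vs , W , e , uq) =
    u , vs , subst (λ s → Walk f u u s (u ∷ vs)) (xor-same (lookup y u)) (balanced-walk W e) , uq

  forced-or-counterexample : ∀ D i → Forced D i ⊎ ∃ λ x → Agree D x × local f i x ≢ lookup y i
  forced-or-counterexample D i = ∀⊎∃ pointwise
    where
    pointwise : ∀ x → (Agree D x → local f i x ≡ lookup y i) ⊎ (Agree D x × local f i x ≢ lookup y i)
    pointwise x with all? (λ j → lookup x j Bool.≟ lookup y j) D | local f i x Bool.≟ lookup y i
    ... | no ¬agree | _       = inj₁ λ agree → contradiction agree ¬agree
    ... | yes _     | yes fxi = inj₁ λ _ → fxi
    ... | yes agree | no fxi≢ = inj₂ (agree , fxi≢)

  unforced⇒balanced-predecessor : FixedPoint f y → ∀ {D R i x} → Covers D R →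
    Agree D x → local f i x ≢ lookup y i → ∃ λ j → j ∈ R × Balanced j i
  unforced⇒balanced-predecessor fy {D} {R} {i} {x} cov agree fxi≢
    with j , y≢x , w , wj , fw , fw′ ←
      edge-across (λ v → local f i v Bool.≟ lookup y i) y x (cong (λ z → lookup z i) fy) fxi≢ =
    j , j∈R , flip⇒Arc f j i w wj fw flipped
    where
    j∈R : j ∈ R
    j∈R = [ (λ j∈D → contradiction (sym (All.lookup agree j∈D)) y≢x) , id ]′ (cov j)
    flipped : local f i (w [ j ]≔ not (lookup y j)) ≡ not (lookup y i)
    flipped = subst (λ b → local f i (w [ j ]≔ b) ≡ not (lookup y i)) (¬-not (y≢x ∘ sym)) (¬-not fw′)

  forced-vertex : ¬ HasPositiveCycle f → FixedPoint f y → ∀ {D R i} → Covers D R → i ∈ R →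
    ∃ λ j → j ∈ R × Forced D j
  forced-vertex npc fy {D} {R} cov i∈R with Any⊎All (forced-or-counterexample D) R
  ... | inj₁ some = find some
  ... | inj₂ none = ⊥-elim (npc (SimpleCycle⇒positive (backward-closed⇒SimpleCycle (_∈ R) pred i∈R)))
    where
    pred : ∀ {j} → j ∈ R → ∃ λ k → k ∈ R × Balanced k j
    pred j∈R with _ , agree , fxj≢ ← All.lookup none j∈R =
      unforced⇒balanced-predecessor fy cov agree fxj≢

  ForcingOrder-exists : ¬ HasPositiveCycle f → FixedPoint f y → ∀ D R → Covers D R →
    ∃ λ π → ForcingOrder D π × π ↭ R
  ForcingOrder-exists npc fy D R = go _ D R refl
    where
    go : ∀ k D R → length R ≡ k → Covers D R → ∃ λ π → ForcingOrder D π × π ↭ R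
    go _       D []      _   _   = [] , [] , ↭-refl
    go (suc k) D (r ∷ R) len cov
      with i , i∈R , forced ← forced-vertex npc fy cov (here refl)
      with R′ , p ← ∈⇒↭∷ i∈R
      with π , order , π↭R′ ← go k (i ∷ D) R′ (suc-injective (trans (sym (↭-length p)) len)) (Covers-move cov p) =
      i ∷ π , forced ∷ order , ↭-trans (↭-prep i π↭R′) (↭-sym p)

  iter-forcing : ∀ {D π x} → ForcingOrder D π → Closed D → Agree D x →
    Agree (π ʳ++ D) (iter f (length π) x)
  iter-forcing []                            _      agree = agree
  iter-forcing {D} {i ∷ π} {x} (forced ∷ order) closed agree =
    subst (Agree (π ʳ++ i ∷ D)) (sym (iter-suc f (length π) x))
      (iter-forcing order closed′ (forced x agree ∷ closed x agree))
    where
    closed′ : Closed (i ∷ D)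
    closed′ z (_ ∷ agree-z) = forced z agree-z ∷ closed z agree-z

  sequential-forcing : ∀ {D π x} → ForcingOrder D π → Agree D x → Agree (π ʳ++ D) (sequential f π x)
  sequential-forcing                   []               agree = agree
  sequential-forcing {D} {i ∷ π} {x} (forced ∷ order) agree =
    sequential-forcing order (subst (Agree (i ∷ D) ∘ (x [ i ]≔_)) (sym (forced x agree)) (Agree-set {x = x} i agree))

theorem1 : ∀ (n : ℕ) (f : BN n) → ¬ HasPositiveCycle f → (y : Config n) →
    (UniqueFixedPoint f y → ∀ x → iter f n x ≡ y) ×
    ((∀ x → iter f n x ≡ y) → ∃ λ (π : List (Fin n)) → π ↭ toList (allFin n) × (∀ x → sequential f π x ≡ y)) ×
    ((∃ λ (π : List (Fin n)) → π ↭ toList (allFin n) × (∀ x → sequential f π x ≡ y)) → UniqueFixedPoint f y)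
theorem1 n f npc y = one⇒two , two⇒three , three⇒one
  where
  open Forcing f y

  order : FixedPoint f y → ∃ λ π → ForcingOrder [] π × π ↭ List.allFin n
  order fy = ForcingOrder-exists npc fy [] (List.allFin n) (inj₂ ∘ ∈-allFin)

  complete : ∀ {π} → π ↭ List.allFin n → ∀ j → j ∈ π ʳ++ []
  complete {π} p j = ∈-resp-↭ (++↭ʳ++ π []) (∈-++⁺ˡ (∈-resp-↭ (↭-sym p) (∈-allFin j)))

  one⇒two : UniqueFixedPoint f y → ∀ x → iter f n x ≡ y
  one⇒two (fy , _) x with π , ord , p ← order fy =
    subst (λ k → iter f k x ≡ y) (trans (↭-length p) (length-tabulate {n = n} id))
      (Agree-complete (complete p) (iter-forcing ord (λ _ _ → []) []))

  two⇒three : (∀ x → iter f n x ≡ y) → ∃ λ π → π ↭ toList (allFin n) × (∀ x → sequential f π x ≡ y)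
  two⇒three const with π , ord , p ← order (iter-constant⇒fixed f n const) =
    π , subst (π ↭_) (sym (toList-allFin n)) p , λ x → Agree-complete (complete p) (sequential-forcing ord [])

  three⇒one : (∃ λ π → π ↭ toList (allFin n) × (∀ x → sequential f π x ≡ y)) → UniqueFixedPoint f y
  three⇒one (π , p , toY) = fy , λ x fx → trans (sym (sequential-fixed f π fx)) (toY x)
    where
    π↭ : π ↭ List.allFin n
    π↭ = subst (π ↭_) (toList-allFin n) p
    fy : FixedPoint f y
    fy = stationary⇒fixed f (All-resp-↭ π↭
      (sequential-stationary f π (Unique-resp-↭ (↭-sym π↭) (allFin⁺ n)) (toY y)))
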